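{- Let $\overline{\Gamma}=(m_1,\alpha_1,\dots,\alpha_{n-1},m_n)$ be a uniform tour starting and ending in depot $v_D$, let $G=(V,A,w)$ be its tour graph, let $t:A\to\mathbb{N}$ give, for each tour arc, the number of cars carried in the corresponding move of $\overline{\Gamma}$, and let $\mathrm{TR}$ be a set of close distance uniform transport requests for $\overline{\Gamma}$. Let $f^{\mathrm{TR}}$ be the transport estimate function for $\mathrm{TR}$ and $f^a$ the traverse counter function of the tour built by the construction algorithm from $\overline{\Gamma}$ and $\mathrm{TR}$. Then (1) $f^{\mathrm{TR}}(a)=t(a)$ for all $a\in A$, and (2) $f^a(a)+f^{\mathrm{TR}}(a)=f^a(a')+f^{\mathrm{TR}}(a')$ for all $a,a'\in A$.
   Context: Convoy capacity $L\in\mathbb{N}$. An action $(j,v,t,x)$ loads $x$ cars ($x>0$, pickup) or unloads $|x|$ cars ($x<0$, drop) at station $v$, $|x|\le L$; a move $(j,v,t_v,v',t_{v'},x)$ carries $x$ cars, $0\le x\le L$. A tour is an alternating sequence of moves and actions of one driver with consistent locations and times and with load of $m_{i+1}$ = load of $m_i$ + $x$ of $\alpha_i$; a tour starting and ending at the depot carries no cars at its start and end. It is uniform if every action has $x\in\{1,-1\}$. Tour graph: nodes are the pickup actions $V^+$, drop actions $V^-$ and one depot node; tour arcs $A$ join consecutive actions, the depot node to the first action, and the last action to the depot node; each tour arc corresponds to a move. A set of close distance uniform transport requests for $\overline{\Gamma}$ is a set $\mathrm{TR}$ of requests $(v,v',1)$, each assigned to a pickup action at $v$ and a drop action at $v'$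 of $\overline{\Gamma}$, every action assigned to exactly one request, such that each pickup action precedes its assigned drop action, at most $L$ actions lie between them, and the tour-arc path from the pickup node to the drop node avoids the arcs at the depot node. Transport arcs go from each request's pickup node to its drop node (transport graph $G^t$). The transport estimate function $f^{\mathrm{TR}}:A\to\mathbb{N}$ gives for each tour arc $a$ the number of requests whose path of tour arcs from pickup node to drop node contains $a$. Construction algorithm: start at the depot node; while not all pickup nodes are visited: at an unvisited pickup node, mark it and traverse its transport arc; otherwise traverse the outgoing tour arc; finally follow tour arcs to the depot node. $f^a(a)$ is the number of times tour arc $a$ is traversed. -}

module Defs where

open import Data.Nat using (ℕ; zero; suc; _+_; _*_; _∸_; _^_; _≤_; _<_; _<ᵇ_; _≤ᵇ_)
open import Data.Nat.Properties using (_<?_)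
open import Data.Fin using (Fin; zero; suc; toℕ; fromℕ; fromℕ<; inject₁; _≟_)
open import Data.Bool using (Bool; true; false; _∧_; _∨_; not; if_then_else_)
open import Data.Maybe using (Maybe; just; nothing)
open import Data.Product using (Σ; _×_; _,_; proj₁)
open import Relation.Nullary using (¬_; yes; no; does)
open import Relation.Binary.PropositionalEquality using (_≡_)

-- A tour (m_1, α_1, …, α_k, m_{k+1}) with k = n-1 actions.  Actions are
-- indexed by Fin k, moves by Fin (suc k): move j is the move preceding
-- action j (j < k), move k is the final move back to the depot.

data Kind : Set where
  pickup drop : Kind

isPickup : Kind → Bool
isPickup pickup = true
isPickup drop   = false

record UniformTour (S : Set) (L k : ℕ) : Set where
  field
    depot   : S
    station : Fin k → S
    kind    : Fin k → Kind
    load    : Fin (suc k) → ℕ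
    load-cap   : ∀ j → load j ≤ L
    load-start : load zero ≡ 0
    load-end   : load (fromℕ k) ≡ 0
    load-pickup : ∀ i → kind i ≡ pickup → load (suc i) ≡ suc (load (inject₁ i))
    load-drop   : ∀ i → kind i ≡ drop   → load (inject₁ i) ≡ suc (load (suc i))

-- Nodes: Fin (suc k), node zero = depot node, node (suc i) =
-- action i.  Tour arcs: Fin (suc k); arc j leaves node j and enters the
-- next node (node j+1, or the depot node for the last arc).  Arc j
-- corresponds to move j of the tour, so  t = load.

Node : ℕ → Set
Node k = Fin (suc k)

Arc : ℕ → Set
Arc k = Fin (suc k)

nextNode : ∀ {k} → Node k → Node k
nextNode {k} j with suc (toℕ j) <? suc k
... | yes p = fromℕ< p
... | no  _ = zero

-- arc j lies on the tour-arc path from the node of action p to the node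
-- of action d (p < d): these are the arcs leaving nodes suc p, …, d,
-- i.e. toℕ p < toℕ j ≤ toℕ d.
onPath : ∀ {k} → Fin k → Fin k → Arc k → Bool
onPath p d j = (toℕ p <ᵇ toℕ j) ∧ (toℕ j ≤ᵇ toℕ d)

record Request (S : Set) (k : ℕ) : Set where
  field
    from to   : S
    pickupAct : Fin k
    dropAct   : Fin k

open Request public

record CloseDistance {S : Set} {L k : ℕ} (Γ : UniformTour S L k) (r : Request S k) : Set where
  open UniformTour Γ
  field
    from-ok   : station (pickupAct r) ≡ from r
    to-ok     : station (dropAct r) ≡ to r
    is-pickup : kind (pickupAct r) ≡ pickup
    is-drop   : kind (dropAct r) ≡ drop
    precedes  : toℕ (pickupAct r) < toℕ (dropAct r)
    between   : toℕ (dropAct r) ∸ suc (toℕ (pickupAct r)) ≤ L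
    -- the tour-arc path avoids the two arcs at the depot node
    avoids    : ∀ j → onPath (pickupAct r) (dropAct r) j ≡ true →
                ¬ (j ≡ zero) × ¬ (j ≡ fromℕ k)

assignedTo : ∀ {S k} → Fin k → Request S k → Set
assignedTo i r = pickupAct r ≡ i Data.Sum.⊎ dropAct r ≡ i
  where import Data.Sum

-- A set of close distance uniform transport requests, given as an
-- injective enumeration TR : Fin m → Request S k (injectivity follows
-- from the exactly-one condition).
record CloseDistanceTR {S : Set} {L k : ℕ} (Γ : UniformTour S L k) (m : ℕ)
                       (TR : Fin m → Request S k) : Set where
  field
    close      : ∀ r → CloseDistance Γ (TR r)
    exactlyOne : ∀ i → Σ (Fin m) λ r → assignedTo i (TR r) × (∀ r' → assignedTo i (TR r') → r' ≡ r)

countFin : ∀ {m} → (Fin m → Bool) → ℕ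
countFin {zero}  P = 0
countFin {suc m} P = (if P zero then 1 else 0) + countFin (λ r → P (suc r))

allFin : ∀ {m} → (Fin m → Bool) → Bool
allFin {zero}  P = true
allFin {suc m} P = P zero ∧ allFin (λ r → P (suc r))

fTR : ∀ {S k m} → (Fin m → Request S k) → Arc k → ℕ
fTR TR a = countFin (λ r → onPath (pickupAct (TR r)) (dropAct (TR r)) a)

module Construction {k : ℕ} (kind : Fin k → Kind) (partner : Fin k → Fin k) where

  incr : Arc k → (Arc k → ℕ) → (Arc k → ℕ)
  incr a c b = if does (a ≟ b) then suc (c b) else c b

  allPickupsVisited : (Fin k → Bool) → Bool
  allPickupsVisited vis = allFin (λ i → not (isPickup (kind i)) ∨ vis i)

  mark : Fin k → (Fin k → Bool) → (Fin k → Bool)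
  mark i vis j = if does (i ≟ j) then true else vis j

  finalWalk : ℕ → Node k → (Arc k → ℕ) → Maybe (Arc k → ℕ)
  finalWalk zero    cur     c = nothing
  finalWalk (suc f) zero    c = just c
  finalWalk (suc f) (suc i) c = finalWalk f (nextNode (suc i)) (incr (suc i) c)

  loop : ℕ → (Fin k → Bool) → Node k → (Arc k → ℕ) → Maybe (Arc k → ℕ)
  loop zero    vis cur c = nothing
  loop (suc f) vis cur c =
    if allPickupsVisited vis then finalWalk (suc f) cur c else step cur
    where
      tourStep : Node k → Maybe (Arc k → ℕ)
      tourStep n = loop f vis (nextNode n) (incr n c)
      step : Node k → Maybe (Arc k → ℕ)
      step zero    = tourStep zero
      step (suc i) = if isPickup (kind i) ∧ not (vis i)
                     then loop f (mark i vis) (suc (partner i)) c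
                     else tourStep (suc i)

  fuel : ℕ
  fuel = 4 * (suc (suc k)) ^ 3

  run : Maybe (Arc k → ℕ)
  run = loop fuel (λ _ → false) zero (λ _ → 0)

traverseCounter : ∀ {S L k m} (Γ : UniformTour S L k) (TR : Fin m → Request S k) →
                  CloseDistanceTR Γ m TR → Maybe (Arc k → ℕ)
traverseCounter Γ TR H =
  Construction.run (UniformTour.kind Γ)
    (λ i → dropAct (TR (proj₁ (CloseDistanceTR.exactlyOne H i))))

module Submission where

-- Let crossing t count the requests whose pickup-to-drop path contains the arc leaving the t-th node.
-- It is 0 at the depot, and passing action i changes the membership of a single request, the one
-- assigned to i: it enters at a pickup and leaves at a drop. So crossing changes exactly like the
-- load, which gives (1).
--
-- For (2), let V count the paths of the requests whose pickup the construction algorithm has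
-- already visited. A tour step adds 1 to the counter of the arc it traverses; a jump from a pickup
-- along its transport arc skips exactly that request's path, which V then takes over. Hence the
-- counters c satisfy c + V = N + 1 on the arcs behind the current node and N on the others. Once
-- every pickup is visited V = f^TR, and completing the lap to the depot makes c + f^TR constant.
-- A potential function shows that the fixed fuel of the algorithm is never exhausted.

open import Defs
open import Data.Nat using (ℕ; zero; suc; _+_; _*_; _∸_; _^_; _≤_; _<_; _<ᵇ_; _≤ᵇ_; z≤n; s≤s; s≤s⁻¹; z<s)
open import Data.Nat.Properties hiding (_≟_)
open import Data.Fin using (Fin; zero; suc; toℕ; inject₁; _≟_)
open import Data.Fin.Properties using (toℕ-inject₁; toℕ-injective; toℕ-fromℕ<; toℕ<n)
  renaming (suc-injective to Fin-suc-injective)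
open import Data.Fin.Induction using (<-weakInduction)
open import Data.Maybe using (Maybe; just)
open import Data.Bool using (Bool; true; false; _∧_; _∨_; not; if_then_else_)
open import Data.Bool.Properties using (∧-zeroʳ; T-≡)
open import Data.Product using (Σ; ∃; _×_; _,_; proj₁; proj₂; uncurry)
open import Data.Sum using (_⊎_; inj₁; inj₂)
open import Function using (_∘_; flip; case_of_)
open import Function.Bundles using (Equivalence)
open import Data.Empty using (⊥-elim)
open import Relation.Nullary using (contradiction; yes; no; does)
open import Relation.Binary.PropositionalEquality
open import Algebra.Properties.CommutativeSemigroup +-commutativeSemigroup using (x∙yz≈y∙xz; xy∙z≈zy∙x)
open ≤-Reasoning

bit : Bool → ℕ
bit b = if b then 1 else 0

countFin-cong : ∀ {m} {P Q : Fin m → Bool} → (∀ r → P r ≡ Q r) → countFin P ≡ countFin Q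
countFin-cong {zero}  P≡Q = refl
countFin-cong {suc m} P≡Q = cong₂ _+_ (cong bit (P≡Q zero)) (countFin-cong (P≡Q ∘ suc))

countFin-false : ∀ m → countFin {m} (λ _ → false) ≡ 0
countFin-false zero    = refl
countFin-false (suc m) = countFin-false m

countFin-≤ : ∀ {m} (P : Fin m → Bool) → countFin P ≤ m
countFin-≤ {zero}  P = z≤n
countFin-≤ {suc m} P with P zero
... | true  = s≤s (countFin-≤ (P ∘ suc))
... | false = m≤n⇒m≤1+n (countFin-≤ (P ∘ suc))

countFin-update : ∀ {m} (P Q : Fin m → Bool) r → (∀ s → s ≢ r → P s ≡ Q s) →
                  countFin P + bit (Q r) ≡ countFin Q + bit (P r)
countFin-update {suc m} P Q zero P≡Q = begin-equality
  bit (P zero) + countFin (P ∘ suc) + bit (Q zero)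
    ≡⟨ cong (λ n → bit (P zero) + n + bit (Q zero)) (countFin-cong (λ s → P≡Q (suc s) λ ())) ⟩
  bit (P zero) + countFin (Q ∘ suc) + bit (Q zero)
    ≡⟨ xy∙z≈zy∙x (bit (P zero)) _ _ ⟩
  bit (Q zero) + countFin (Q ∘ suc) + bit (P zero) ∎
countFin-update {suc m} P Q (suc r) P≡Q = begin-equality
  bit (P zero) + countFin (P ∘ suc) + bit (Q (suc r))
    ≡⟨ +-assoc (bit (P zero)) _ _ ⟩
  bit (P zero) + (countFin (P ∘ suc) + bit (Q (suc r)))
    ≡⟨ cong₂ _+_ (cong bit (P≡Q zero λ ()))
               (countFin-update (P ∘ suc) (Q ∘ suc) r (λ s s≢r → P≡Q (suc s) (s≢r ∘ Fin-suc-injective))) ⟩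
  bit (Q zero) + (countFin (Q ∘ suc) + bit (P (suc r)))
    ≡⟨ +-assoc (bit (Q zero)) _ _ ⟨
  bit (Q zero) + countFin (Q ∘ suc) + bit (P (suc r)) ∎

allFin-true : ∀ {m} (P : Fin m → Bool) → allFin P ≡ true → ∀ i → P i ≡ true
allFin-true {suc m} P all i with P zero in P0
allFin-true P ()  i       | false
allFin-true P all zero    | true = P0
allFin-true P all (suc i) | true = allFin-true (P ∘ suc) all i

allFin-false : ∀ {m} (P : Fin m → Bool) → allFin P ≡ false → ∃ λ i → P i ≡ false
allFin-false {suc m} P none with P zero in P0
... | false = zero , P0
... | true  = let i , Pi = allFin-false (P ∘ suc) none in suc i , Pi

+bit-cancel : ∀ {x y b c} → x + bit b ≡ y + bit c → b ≡ false → c ≡ true → x ≡ suc y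
+bit-cancel {x} {y} eq refl refl = trans (sym (+-identityʳ x)) (trans eq (+-comm y 1))

not-∨-false : ∀ {x y} → not x ∨ y ≡ false → x ∧ not y ≡ true
not-∨-false {true} {false} refl = refl

<ᵇ-true : ∀ {m n} → m < n → (m <ᵇ n) ≡ true
<ᵇ-true = Equivalence.to T-≡ ∘ <⇒<ᵇ

<ᵇ-false : ∀ {m n} → n ≤ m → (m <ᵇ n) ≡ false
<ᵇ-false {m}     {zero}  _         = refl
<ᵇ-false {suc m} {suc n} (s≤s n≤m) = <ᵇ-false n≤m

<ᵇ-suc : ∀ m n → m ≢ n → (m <ᵇ suc n) ≡ (m <ᵇ n)
<ᵇ-suc zero    zero    m≢n = contradiction refl m≢n
<ᵇ-suc zero    (suc n) _   = refl
<ᵇ-suc (suc m) zero    _   = refl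
<ᵇ-suc (suc m) (suc n) m≢n = <ᵇ-suc m n (m≢n ∘ cong suc)

≤ᵇ≡<ᵇ-suc : ∀ m n → (m ≤ᵇ n) ≡ (m <ᵇ suc n)
≤ᵇ≡<ᵇ-suc zero    n = refl
≤ᵇ≡<ᵇ-suc (suc m) n = refl

inInterval : ℕ → ℕ → ℕ → Bool
inInterval p d t = (p <ᵇ t) ∧ (t ≤ᵇ d)

inInterval-suc : ∀ {p d t} → p ≢ t → t ≢ d → inInterval p d (suc t) ≡ inInterval p d t
inInterval-suc {p} {d} {t} p≢t t≢d =
  cong₂ _∧_ (<ᵇ-suc p t p≢t) (sym (trans (≤ᵇ≡<ᵇ-suc t d) (<ᵇ-suc t d t≢d)))

inInterval-at-start : ∀ {p d} → p < d → inInterval p d p ≡ false × inInterval p d (suc p) ≡ true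
inInterval-at-start {p} {d} p<d =
  cong (_∧ (p ≤ᵇ d)) (<ᵇ-false {p} ≤-refl) , cong₂ _∧_ (<ᵇ-true (n<1+n p)) (<ᵇ-true p<d)

inInterval-at-end : ∀ {p d} → p < d → inInterval p d d ≡ true × inInterval p d (suc d) ≡ false
inInterval-at-end {p} {d} p<d =
  cong₂ _∧_ (<ᵇ-true p<d) (trans (≤ᵇ≡<ᵇ-suc d d) (<ᵇ-true (n<1+n d))) ,
  trans (cong ((p <ᵇ suc d) ∧_) (<ᵇ-false {d} ≤-refl)) (∧-zeroʳ _)

inInterval-split : ∀ {p d} → p < d → ∀ t → bit (t <ᵇ suc d) ≡ bit (t <ᵇ suc p) + bit (inInterval p d t)
inInterval-split {p} {d} p<d t with t ≤? p | t ≤? d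
... | yes t≤p | _
  rewrite <ᵇ-true (s≤s (≤-trans t≤p (<⇒≤ p<d))) | <ᵇ-true (s≤s t≤p) | <ᵇ-false {p} t≤p = refl
... | no t≰p | yes t≤d
  rewrite ≤ᵇ≡<ᵇ-suc t d | <ᵇ-true (s≤s t≤d) | <ᵇ-false (≰⇒> t≰p) | <ᵇ-true (≰⇒> t≰p) = refl
... | no t≰p | no t≰d
  rewrite ≤ᵇ≡<ᵇ-suc t d | <ᵇ-false (≰⇒> t≰d) | <ᵇ-false (≰⇒> t≰p) | ∧-zeroʳ (p <ᵇ t) = refl

module Assignment {S : Set} {L k m : ℕ} (Γ : UniformTour S L k) (TR : Fin m → Request S k)
                  (H : CloseDistanceTR Γ m TR) where
  open UniformTour Γ
  open CloseDistanceTR H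
  open CloseDistance using (precedes; is-pickup; is-drop)

  pickupOf dropOf : Fin m → Fin k
  pickupOf r = pickupAct (TR r)
  dropOf   r = dropAct (TR r)

  pickup<drop : ∀ r → toℕ (pickupOf r) < toℕ (dropOf r)
  pickup<drop r = precedes (close r)

  kind-pickupOf : ∀ r → kind (pickupOf r) ≡ pickup
  kind-pickupOf r = is-pickup (close r)

  kind-dropOf : ∀ r → kind (dropOf r) ≡ drop
  kind-dropOf r = is-drop (close r)

  requestAt : Fin k → Fin m
  requestAt i = proj₁ (exactlyOne i)

  requestAt-unique : ∀ {i r} → pickupOf r ≡ i ⊎ dropOf r ≡ i → r ≡ requestAt i
  requestAt-unique {i} {r} = proj₂ (proj₂ (exactlyOne i)) r

  pickupOf-requestAt : ∀ i → kind i ≡ pickup → pickupOf (requestAt i) ≡ i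
  pickupOf-requestAt i pick with proj₁ (proj₂ (exactlyOne i))
  ... | inj₁ picked  = picked
  ... | inj₂ dropped with () ← trans (sym pick) (trans (cong kind (sym dropped)) (kind-dropOf (requestAt i)))

  dropOf-requestAt : ∀ i → kind i ≡ drop → dropOf (requestAt i) ≡ i
  dropOf-requestAt i dr with proj₁ (proj₂ (exactlyOne i))
  ... | inj₂ dropped = dropped
  ... | inj₁ picked  with () ← trans (sym (kind-pickupOf (requestAt i))) (trans (cong kind picked) dr)

  covers : Fin m → ℕ → Bool
  covers r = inInterval (toℕ (pickupOf r)) (toℕ (dropOf r))

  crossing : ℕ → ℕ
  crossing t = countFin (λ r → covers r t)

  crossing-step : ∀ i → crossing (suc (toℕ i)) + bit (covers (requestAt i) (toℕ i))
                      ≡ crossing (toℕ i) + bit (covers (requestAt i) (suc (toℕ i)))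
  crossing-step i = countFin-update _ _ (requestAt i) λ r r≢ →
    inInterval-suc (r≢ ∘ requestAt-unique ∘ inj₁ ∘ toℕ-injective)
                   (r≢ ∘ requestAt-unique ∘ inj₂ ∘ toℕ-injective ∘ sym)

  covers-around-pickup : ∀ i → kind i ≡ pickup →
                         covers (requestAt i) (toℕ i) ≡ false × covers (requestAt i) (suc (toℕ i)) ≡ true
  covers-around-pickup i pick =
    subst (λ t → covers (requestAt i) t ≡ false × covers (requestAt i) (suc t) ≡ true)
          (cong toℕ (pickupOf-requestAt i pick)) (inInterval-at-start (pickup<drop (requestAt i)))

  covers-around-drop : ∀ i → kind i ≡ drop →
                       covers (requestAt i) (toℕ i) ≡ true × covers (requestAt i) (suc (toℕ i)) ≡ false
  covers-around-drop i dr =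
    subst (λ t → covers (requestAt i) t ≡ true × covers (requestAt i) (suc t) ≡ false)
          (cong toℕ (dropOf-requestAt i dr)) (inInterval-at-end (pickup<drop (requestAt i)))

  crossing-pickup : ∀ i → kind i ≡ pickup → crossing (suc (toℕ i)) ≡ suc (crossing (toℕ i))
  crossing-pickup i pick = uncurry (+bit-cancel (crossing-step i)) (covers-around-pickup i pick)

  crossing-drop : ∀ i → kind i ≡ drop → crossing (toℕ i) ≡ suc (crossing (suc (toℕ i)))
  crossing-drop i dr = uncurry (flip (+bit-cancel (sym (crossing-step i)))) (covers-around-drop i dr)

  crossing≡load : ∀ a → crossing (toℕ a) ≡ load a
  crossing≡load = <-weakInduction (λ a → crossing (toℕ a) ≡ load a)
                                  (trans (countFin-false m) (sym load-start)) step
    where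
      step : ∀ i → crossing (toℕ (inject₁ i)) ≡ load (inject₁ i) → crossing (suc (toℕ i)) ≡ load (suc i)
      step i ih rewrite toℕ-inject₁ i with kind i in kind-i
      ... | pickup = trans (crossing-pickup i kind-i) (trans (cong suc ih) (sym (load-pickup i kind-i)))
      ... | drop   = suc-injective (trans (sym (crossing-drop i kind-i)) (trans ih (load-drop i kind-i)))

nextNode-cases : ∀ {k} (n : Node k) →
  (toℕ n < k × toℕ (nextNode n) ≡ suc (toℕ n)) ⊎ (toℕ n ≡ k × nextNode n ≡ zero)
nextNode-cases {k} n with suc (toℕ n) <? suc k
... | yes n<k = inj₁ (s≤s⁻¹ n<k , toℕ-fromℕ< n<k)
... | no  n≮k = inj₂ (≤-antisym (s≤s⁻¹ (toℕ<n n)) (≮⇒≥ (n≮k ∘ s≤s)) , refl)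

<-last : ∀ {k} {a n : Fin (suc k)} → toℕ n ≡ k → a ≢ n → toℕ a < toℕ n
<-last {a = a} last a≢n = ≤∧≢⇒< (subst (toℕ a ≤_) (sym last) (s≤s⁻¹ (toℕ<n a))) (a≢n ∘ toℕ-injective)

<ᵇ-suc-bit : ∀ {j} (n a : Fin j) → bit (toℕ a <ᵇ suc (toℕ n)) ≡ bit (does (n ≟ a)) + bit (toℕ a <ᵇ toℕ n)
<ᵇ-suc-bit n a with n ≟ a
... | yes refl rewrite <ᵇ-true (n<1+n (toℕ n)) | <ᵇ-false {toℕ n} ≤-refl = refl
... | no  n≢a  = cong bit (<ᵇ-suc (toℕ a) (toℕ n) (n≢a ∘ sym ∘ toℕ-injective))

last-bit : ∀ {k} {n : Fin (suc k)} → toℕ n ≡ k → ∀ a → bit (does (n ≟ a)) + bit (toℕ a <ᵇ toℕ n) ≡ 1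
last-bit {n = n} last a with n ≟ a
... | yes refl rewrite <ᵇ-false {toℕ n} ≤-refl = refl
... | no  n≢a  rewrite <ᵇ-true (<-last last (n≢a ∘ sym)) = refl

module Traversal {S : Set} {L k m : ℕ} (Γ : UniformTour S L k) (TR : Fin m → Request S k)
                 (H : CloseDistanceTR Γ m TR) where
  open UniformTour Γ using (kind)
  open Assignment Γ TR H

  open Construction kind (dropOf ∘ requestAt)

  incr-+ : ∀ n c a x → incr n c a + x ≡ bit (does (n ≟ a)) + (c a + x)
  incr-+ n c a x with does (n ≟ a)
  ... | true  = refl
  ... | false = refl

  Levelled : (Arc k → ℕ) → Node k → (Arc k → ℕ) → Set
  Levelled X cur c = ∃ λ N → ∀ a → c a + X a ≡ N + bit (toℕ a <ᵇ toℕ cur)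

  incr-levelled : ∀ {X c : Arc k → ℕ} {n N} → (∀ a → c a + X a ≡ N + bit (toℕ a <ᵇ toℕ n)) →
                  ∀ a → incr n c a + X a ≡ N + (bit (does (n ≟ a)) + bit (toℕ a <ᵇ toℕ n))
  incr-levelled {X} {c} {n} {N} lev a = begin-equality
    incr n c a + X a                                ≡⟨ incr-+ n c a (X a) ⟩
    bit (does (n ≟ a)) + (c a + X a)                ≡⟨ cong (bit (does (n ≟ a)) +_) (lev a) ⟩
    bit (does (n ≟ a)) + (N + bit (toℕ a <ᵇ toℕ n)) ≡⟨ x∙yz≈y∙xz (bit (does (n ≟ a))) N _ ⟩
    N + (bit (does (n ≟ a)) + bit (toℕ a <ᵇ toℕ n)) ∎

  levelled-step : ∀ {X c : Arc k → ℕ} {n} → Levelled X n c → Levelled X (nextNode n) (incr n c)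
  levelled-step {X} {c} {n} (N , lev) with nextNode-cases n
  ... | inj₁ (_ , next) = N , λ a → begin-equality
    incr n c a + X a                                ≡⟨ incr-levelled {X} {c} {n} lev a ⟩
    N + (bit (does (n ≟ a)) + bit (toℕ a <ᵇ toℕ n)) ≡⟨ cong (N +_) (<ᵇ-suc-bit n a) ⟨
    N + bit (toℕ a <ᵇ suc (toℕ n))                  ≡⟨ cong (λ t → N + bit (toℕ a <ᵇ t)) next ⟨
    N + bit (toℕ a <ᵇ toℕ (nextNode n))             ∎
  ... | inj₂ (last , next) = suc N , λ a → begin-equality
    incr n c a + X a                                ≡⟨ incr-levelled {X} {c} {n} lev a ⟩
    N + (bit (does (n ≟ a)) + bit (toℕ a <ᵇ toℕ n)) ≡⟨ cong (N +_) (last-bit last a) ⟩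
    N + 1                                           ≡⟨ +-comm N 1 ⟩
    suc N                                           ≡⟨ +-identityʳ (suc N) ⟨
    suc N + 0                                       ≡⟨ cong (λ b → suc N + bit b) (<ᵇ-false {toℕ a} z≤n) ⟨
    suc N + bit (toℕ a <ᵇ 0)                        ≡⟨ cong (λ t → suc N + bit (toℕ a <ᵇ toℕ t)) next ⟨
    suc N + bit (toℕ a <ᵇ toℕ (nextNode n))         ∎

  unvisitedPickup : (Fin k → Bool) → Fin k → Bool
  unvisitedPickup vis i = isPickup (kind i) ∧ not (vis i)

  unvisitedPickup-true : ∀ {vis i} → unvisitedPickup vis i ≡ true → kind i ≡ pickup × vis i ≡ false
  unvisitedPickup-true {vis} {i} new with kind i | vis i
  ... | pickup | false = refl , refl

  allPickupsVisited-true : ∀ {vis} → allPickupsVisited vis ≡ true → ∀ i → kind i ≡ pickup → vis i ≡ true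
  allPickupsVisited-true {vis} all i pick with allFin-true _ all i
  ... | visited rewrite pick = visited

  allPickupsVisited-false : ∀ {vis} → allPickupsVisited vis ≡ false → ∃ λ i → unvisitedPickup vis i ≡ true
  allPickupsVisited-false pending =
    let i , unvisited = allFin-false _ pending in i , not-∨-false {isPickup (kind i)} unvisited

  mark-same : ∀ i vis → mark i vis i ≡ true
  mark-same i vis with i ≟ i
  ... | yes _   = refl
  ... | no  i≢i = contradiction refl i≢i

  mark-other : ∀ {i j} vis → i ≢ j → mark i vis j ≡ vis j
  mark-other {i} {j} vis i≢j with i ≟ j
  ... | yes i≡j = contradiction i≡j i≢j
  ... | no  _   = refl

  visitedLoad : (Fin k → Bool) → Arc k → ℕ
  visitedLoad vis a = countFin (λ r → vis (pickupOf r) ∧ covers r (toℕ a))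

  visitedLoad-mark : ∀ {vis i} → unvisitedPickup vis i ≡ true →
                     ∀ a → visitedLoad (mark i vis) a ≡ visitedLoad vis a + bit (covers (requestAt i) (toℕ a))
  visitedLoad-mark {vis} {i} new a = begin-equality
    countFin marked                         ≡⟨ +-identityʳ _ ⟨
    countFin marked + bit false             ≡⟨ cong (λ b → countFin marked + bit (b ∧ covers r t)) unmarked-r ⟨
    countFin marked + bit (unmarked r)      ≡⟨ countFin-update marked unmarked r others ⟩
    countFin unmarked + bit (marked r)      ≡⟨ cong (λ b → countFin unmarked + bit (b ∧ covers r t)) marked-r ⟩
    countFin unmarked + bit (covers r t)    ∎
    where
      r : Fin m
      r = requestAt i
      t : ℕ
      t = toℕ a
      marked unmarked : Fin m → Bool
      marked   s = mark i vis (pickupOf s) ∧ covers s t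
      unmarked s = vis (pickupOf s) ∧ covers s t
      picked : pickupOf r ≡ i
      picked = pickupOf-requestAt i (proj₁ (unvisitedPickup-true {vis} new))
      unmarked-r : vis (pickupOf r) ≡ false
      unmarked-r = trans (cong vis picked) (proj₂ (unvisitedPickup-true {vis} new))
      marked-r : mark i vis (pickupOf r) ≡ true
      marked-r = trans (cong (mark i vis) picked) (mark-same i vis)
      others : ∀ s → s ≢ r → marked s ≡ unmarked s
      others s s≢r = cong (_∧ covers s t) (mark-other vis (s≢r ∘ requestAt-unique ∘ inj₁ ∘ sym))

  levelled-jump : ∀ {vis i c} → unvisitedPickup vis i ≡ true →
                  Levelled (visitedLoad vis) (suc i) c →
                  Levelled (visitedLoad (mark i vis)) (suc (dropOf (requestAt i))) c
  levelled-jump {vis} {i} {c} new (N , lev) = N , λ a → let t = toℕ a in begin-equality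
    c a + visitedLoad (mark i vis) a                        ≡⟨ cong (c a +_) (visitedLoad-mark new a) ⟩
    c a + (visitedLoad vis a + bit (covers r t))            ≡⟨ +-assoc (c a) _ _ ⟨
    c a + visitedLoad vis a + bit (covers r t)              ≡⟨ cong (_+ bit (covers r t)) (lev a) ⟩
    N + bit (t <ᵇ suc (toℕ i)) + bit (covers r t)           ≡⟨ +-assoc N _ _ ⟩
    N + (bit (t <ᵇ suc (toℕ i)) + bit (covers r t))
      ≡⟨ cong (λ j → N + (bit (t <ᵇ suc (toℕ j)) + bit (covers r t))) picked ⟨
    N + (bit (t <ᵇ suc (toℕ (pickupOf r))) + bit (covers r t))
      ≡⟨ cong (N +_) (inInterval-split (pickup<drop r) t) ⟨
    N + bit (t <ᵇ suc (toℕ (dropOf r)))                     ∎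
    where
      r : Fin m
      r = requestAt i
      picked : pickupOf r ≡ i
      picked = pickupOf-requestAt i (proj₁ (unvisitedPickup-true {vis} new))

  levelled-cong : ∀ {X Y cur c} → (∀ a → X a ≡ Y a) → Levelled X cur c → Levelled Y cur c
  levelled-cong X≡Y (N , lev) = N , λ a → trans (cong (_ +_) (sym (X≡Y a))) (lev a)

  visitedLoad-all : ∀ {vis} → allPickupsVisited vis ≡ true → ∀ a → visitedLoad vis a ≡ fTR TR a
  visitedLoad-all all a = countFin-cong λ r →
    cong (_∧ covers r (toℕ a)) (allPickupsVisited-true all (pickupOf r) (kind-pickupOf r))

  Balanced : (Arc k → ℕ) → Set
  Balanced fa = ∀ a a' → fa a + fTR TR a ≡ fa a' + fTR TR a'

  Yields : Maybe (Arc k → ℕ) → Set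
  Yields result = ∃ λ fa → result ≡ just fa × Balanced fa

  levelled-depot : ∀ {c} → Levelled (fTR TR) zero c → Balanced c
  levelled-depot (N , lev) a a' = begin-equality
    _ + fTR TR a             ≡⟨ lev a ⟩
    N + bit (toℕ a <ᵇ 0)     ≡⟨ cong (λ b → N + bit b) (trans (<ᵇ-false {toℕ a} z≤n) (sym (<ᵇ-false {toℕ a'} z≤n))) ⟩
    N + bit (toℕ a' <ᵇ 0)    ≡⟨ lev a' ⟨
    _ + fTR TR a'            ∎

  lap : ℕ
  lap = 2 + k

  toEnd : Node k → ℕ
  toEnd cur = 2 + (k ∸ toℕ cur)

  toEnd≤lap : ∀ cur → toEnd cur ≤ lap
  toEnd≤lap cur = +-monoʳ-≤ 2 (m∸n≤m k (toℕ cur))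

  toEnd-forward : ∀ {cur next : Node k} → toℕ cur < k → toℕ next ≡ suc (toℕ cur) → toEnd next < toEnd cur
  toEnd-forward {cur} {next} cur<k next≡ = s≤s (s≤s (begin-strict
    k ∸ toℕ next       ≡⟨ cong (k ∸_) next≡ ⟩
    k ∸ suc (toℕ cur)  <⟨ ∸-monoʳ-< (n<1+n (toℕ cur)) cur<k ⟩
    k ∸ toℕ cur        ∎))

  -- The second alternative covers the last step home, which may reach the depot with one unit of fuel left.
  HomeFuel : ℕ → Node k → Set
  HomeFuel f cur = toEnd cur ≤ f ⊎ (cur ≡ zero × 1 ≤ f)

  homeFuel-step : ∀ {f} n → toEnd n ≤ suc f → HomeFuel f (nextNode n)
  homeFuel-step n fuel with nextNode-cases n
  ... | inj₁ (n<k , next) = inj₁ (s≤s⁻¹ (<-≤-trans (toEnd-forward n<k next) fuel))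
  ... | inj₂ (_ , next)   = inj₂ (next , s≤s⁻¹ (≤-trans (m≤m+n 2 _) fuel))

  finalWalk-yields : ∀ f cur c → Levelled (fTR TR) cur c → HomeFuel f cur → Yields (finalWalk f cur c)
  finalWalk-yields zero    _       c lev (inj₁ ())
  finalWalk-yields zero    _       c lev (inj₂ (_ , ()))
  finalWalk-yields (suc f) zero    c lev _ = c , refl , levelled-depot lev
  finalWalk-yields (suc f) (suc i) c lev (inj₂ (() , _))
  finalWalk-yields (suc f) (suc i) c lev (inj₁ fuel) =
    finalWalk-yields f (nextNode (suc i)) (incr (suc i) c) (levelled-step lev) (homeFuel-step (suc i) fuel)

  unvisitedCount : (Fin k → Bool) → ℕ
  unvisitedCount vis = countFin (unvisitedPickup vis)

  unvisitedCount-mark : ∀ {vis i} → unvisitedPickup vis i ≡ true →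
                        unvisitedCount vis ≡ suc (unvisitedCount (mark i vis))
  unvisitedCount-mark {vis} {i} new = begin-equality
    unvisitedCount vis                                       ≡⟨ +-identityʳ _ ⟨
    unvisitedCount vis + 0                                   ≡⟨ cong (λ b → unvisitedCount vis + bit b) now-visited ⟨
    unvisitedCount vis + bit (unvisitedPickup (mark i vis) i) ≡⟨ countFin-update _ _ i others ⟨
    unvisitedCount (mark i vis) + bit (unvisitedPickup vis i) ≡⟨ cong (λ b → unvisitedCount (mark i vis) + bit b) new ⟩
    unvisitedCount (mark i vis) + 1                          ≡⟨ +-comm _ 1 ⟩
    suc (unvisitedCount (mark i vis))                        ∎
    where
      now-visited : unvisitedPickup (mark i vis) i ≡ false
      now-visited = trans (cong (λ b → isPickup (kind i) ∧ not b) (mark-same i vis)) (∧-zeroʳ _)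
      others : ∀ j → j ≢ i → unvisitedPickup (mark i vis) j ≡ unvisitedPickup vis j
      others j j≢i = cong (λ b → isPickup (kind j) ∧ not b) (mark-other vis (j≢i ∘ sym))

  lapReserve : Bool → ℕ
  lapReserve true  = 0
  lapReserve false = lap

  -- Each iteration decreases the potential: a tour step decreases toEnd, passing the depot spends the
  -- lap reserve, and a jump visits a pickup, each of which is worth two laps.
  potential : (Fin k → Bool) → Node k → Bool → ℕ
  potential vis cur lapped = toEnd cur + (lapReserve lapped + unvisitedCount vis * (lap + lap))

  potential-forward : ∀ vis lapped {cur next} → toℕ cur < k → toℕ next ≡ suc (toℕ cur) →
                      potential vis next lapped < potential vis cur lapped
  potential-forward _ _ cur<k next≡ = +-monoˡ-< _ (toEnd-forward cur<k next≡)

  potential-wrap : ∀ vis {cur} → toℕ cur ≡ k → potential vis zero true < potential vis cur false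
  potential-wrap vis {cur} last = begin-strict
    lap + rest            <⟨ m<n+m _ {2} z<s ⟩
    2 + (lap + rest)      ≡⟨ cong (λ t → 2 + t + (lap + rest)) (trans (cong (k ∸_) last) (n∸n≡0 k)) ⟨
    potential vis cur false ∎
    where
      rest : ℕ
      rest = unvisitedCount vis * (lap + lap)

  potential-jump : ∀ vis {i} lapped → unvisitedPickup vis i ≡ true →
                   potential (mark i vis) (suc (dropOf (requestAt i))) false < potential vis (suc i) lapped
  potential-jump vis {i} lapped new = begin-strict
    toEnd (suc (dropOf (requestAt i))) + (lap + U′ * W) ≤⟨ +-monoˡ-≤ _ (toEnd≤lap (suc (dropOf (requestAt i)))) ⟩
    lap + (lap + U′ * W)                               ≡⟨ +-assoc lap lap _ ⟨
    suc U′ * W                                         <⟨ m<n+m _ {2} z<s ⟩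
    2 + suc U′ * W                                     ≤⟨ +-mono-≤ (m≤m+n 2 (k ∸ toℕ (suc i))) (m≤n+m _ (lapReserve lapped)) ⟩
    toEnd (suc i) + (lapReserve lapped + suc U′ * W)
      ≡⟨ cong (λ u → toEnd (suc i) + (lapReserve lapped + u * W)) (unvisitedCount-mark new) ⟨
    potential vis (suc i) lapped                       ∎
    where
      U′ W : ℕ
      U′ = unvisitedCount (mark i vis)
      W  = lap + lap

  initial-potential : potential (λ _ → false) zero false ≤ fuel
  initial-potential = begin
    lap + (lap + U₀ * W)                           ≤⟨ +-monoʳ-≤ lap (+-monoʳ-≤ lap (*-monoˡ-≤ W U₀≤k)) ⟩
    lap + (lap + k * W)                            ≡⟨ +-assoc lap lap (k * W) ⟨
    suc k * W                                      ≤⟨ *-monoˡ-≤ W (n≤1+n (suc k)) ⟩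
    lap * W                                        ≡⟨ *-distribˡ-+ lap lap lap ⟩
    lap * lap + lap * lap                          ≤⟨ +-mono-≤ lap²≤lap³ (≤-trans lap²≤lap³ (m≤m+n _ _)) ⟩
    4 * lap ^ 3                                    ∎
    where
      U₀ W : ℕ
      U₀ = unvisitedCount (λ _ → false)
      W  = lap + lap
      U₀≤k : U₀ ≤ k
      U₀≤k = countFin-≤ (unvisitedPickup (λ _ → false))
      lap²≤lap³ : lap * lap ≤ lap ^ 3
      lap²≤lap³ = *-monoʳ-≤ lap (m≤m*n lap (lap * 1))

  atUnvisitedPickup : (Fin k → Bool) → Node k → Bool
  atUnvisitedPickup vis zero    = false
  atUnvisitedPickup vis (suc i) = unvisitedPickup vis i

  ≤-unvisited : ∀ {vis cur j} → atUnvisitedPickup vis cur ≡ false → unvisitedPickup vis j ≡ true →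
                toℕ cur ≤ suc (toℕ j) → toℕ cur ≤ toℕ j
  ≤-unvisited {vis} here new cur≤ = s≤s⁻¹ (≤∧≢⇒< cur≤ λ cur≡ →
    case trans (sym here) (trans (cong (atUnvisitedPickup vis) (toℕ-injective cur≡)) new) of λ ())

  -- After passing the depot an unvisited pickup lies ahead, so the depot is not passed again
  -- before the next jump.
  PendingAhead : (Fin k → Bool) → Node k → Bool → Set
  PendingAhead vis cur lapped = lapped ≡ true → ∃ λ j → unvisitedPickup vis j ≡ true × toℕ cur ≤ suc (toℕ j)

  allVisited-yields : ∀ {f} vis cur c lapped → allPickupsVisited vis ≡ true →
                      Levelled (visitedLoad vis) cur c → potential vis cur lapped ≤ f →
                      Yields (finalWalk f cur c)
  allVisited-yields vis cur c lapped all lev fuel =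
    finalWalk-yields _ cur c (levelled-cong {cur = cur} (visitedLoad-all {vis} all) lev)
                     (inj₁ (≤-trans (m≤m+n _ _) fuel))

  mutual
    loop-yields : ∀ f vis cur c lapped → Levelled (visitedLoad vis) cur c → PendingAhead vis cur lapped →
                  potential vis cur lapped ≤ f → Yields (loop f vis cur c)
    loop-yields (suc f) vis zero c lapped lev ahead fuel with allPickupsVisited vis in all
    ... | true  = allVisited-yields vis zero c lapped all lev fuel
    ... | false = tourStep-yields f vis zero c lapped all refl lev ahead fuel
    loop-yields (suc f) vis (suc i) c lapped lev ahead fuel
      with allPickupsVisited vis in all | unvisitedPickup vis i in new
    ... | true  | _     = allVisited-yields vis (suc i) c lapped all lev fuel
    ... | false | true  = loop-yields f (mark i vis) (suc (dropOf (requestAt i))) c false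
                            (levelled-jump {vis} {i} {c} new lev) (λ ())
                            (s≤s⁻¹ (<-≤-trans (potential-jump vis lapped new) fuel))
    ... | false | false = tourStep-yields f vis (suc i) c lapped all new lev ahead fuel

    tourStep-yields : ∀ f vis cur c lapped → allPickupsVisited vis ≡ false →
                      atUnvisitedPickup vis cur ≡ false → Levelled (visitedLoad vis) cur c →
                      PendingAhead vis cur lapped → potential vis cur lapped ≤ suc f →
                      Yields (loop f vis (nextNode cur) (incr cur c))
    tourStep-yields f vis cur c lapped pending here lev ahead fuel with nextNode-cases cur
    ... | inj₁ (cur<k , next) =
      loop-yields f vis (nextNode cur) (incr cur c) lapped (levelled-step lev) ahead′
                  (s≤s⁻¹ (<-≤-trans (potential-forward vis lapped cur<k next) fuel))
      where
        ahead′ : PendingAhead vis (nextNode cur) lapped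
        ahead′ lapped≡ = let j , new , cur≤ = ahead lapped≡ in
          j , new , subst (_≤ suc (toℕ j)) (sym next) (s≤s (≤-unvisited here new cur≤))
    ... | inj₂ (last , next) with lapped
    ...   | true  = let j , new , cur≤ = ahead refl in
                    ⊥-elim (<⇒≱ (toℕ<n j) (subst (_≤ toℕ j) last (≤-unvisited here new cur≤)))
    ...   | false =
      loop-yields f vis (nextNode cur) (incr cur c) true (levelled-step lev) ahead′
                  (subst (λ n → potential vis n true ≤ f) (sym next)
                         (s≤s⁻¹ (<-≤-trans (potential-wrap vis last) fuel)))
      where
        ahead′ : PendingAhead vis (nextNode cur) true
        ahead′ _ = let j , new = allPickupsVisited-false pending in
          j , new , subst (_≤ suc (toℕ j)) (sym (cong toℕ next)) z≤n

  traverseCounter-yields : Yields (traverseCounter Γ TR H)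
  traverseCounter-yields =
    loop-yields fuel (λ _ → false) zero (λ _ → 0) false
                (0 , λ a → trans (countFin-false m) (cong bit (sym (<ᵇ-false {toℕ a} z≤n))))
                (λ ()) initial-potential

lemma4 : {S : Set} {L k m : ℕ} (Γ : UniformTour S L k) (TR : Fin m → Request S k)
         (H : CloseDistanceTR Γ m TR) →
         (∀ a → fTR TR a ≡ UniformTour.load Γ a)
         × Σ (Arc k → ℕ) (λ fa → traverseCounter Γ TR H ≡ just fa
              × (∀ a a' → fa a + fTR TR a ≡ fa a' + fTR TR a'))
lemma4 Γ TR H = Assignment.crossing≡load Γ TR H , Traversal.traverseCounter-yields Γ TR H
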